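{- Let $G$ be a connected graph of order $n$ with minimum degree $\delta(G)\ge 2$, maximum degree $\Delta(G)\ge 3$ and girth $\mathtt{g}(G)\ge 4$. If $G$ is $k$-metric dimensional, then $$k\le n-1-(\Delta(G)-2)\sum_{i=0}^{\lfloor \mathtt{g}(G)/2\rfloor-2}(\delta(G)-1)^i.$$
   Context: Graphs are finite, simple, connected; $d_G$ is the shortest-path distance. A vertex $w$ distinguishes $x,y$ if $d_G(x,w)\ne d_G(y,w)$; a set $S\subseteq V(G)$ is a $k$-metric generator if every pair of distinct vertices is distinguished by at least $k$ elements of $S$; $G$ is $k$-metric dimensional if $k$ is the largest integer for which a $k$-metric generator exists. The girth $\mathtt{g}(G)$ is the length of a shortest cycle in $G$. -}

module Defs where

open import Data.Nat using (ℕ; zero; suc; _+_; _*_; _∸_; _^_; _≤_; _<_)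
open import Data.Fin using (Fin; zero; suc; inject₁; fromℕ)
open import Data.Empty using (⊥)
open import Data.Bool using (Bool; T)
open import Data.List using (List; length; filterᵇ; allFin)
open import Data.Product using (Σ; ∃; _×_; _,_)
open import Relation.Binary.PropositionalEquality using (_≡_; _≢_)
open import Relation.Nullary using (¬_)
open import Function.Definitions using (Injective)

record Graph (n : ℕ) : Set where
  field
    edge  : Fin n → Fin n → Bool
    sym   : ∀ x y → edge x y ≡ edge y x
    irrefl : ∀ x → ¬ T (edge x x)

module _ {n : ℕ} (G : Graph n) where
  open Graph G

  Adj : Fin n → Fin n → Set
  Adj x y = T (edge x y)

  degree : Fin n → ℕ
  degree v = length (filterᵇ (edge v) (allFin n))

  data Walk : Fin n → Fin n → ℕ → Set where
    here : ∀ {x} → Walk x x zero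
    step : ∀ {x y z ℓ} → Adj x y → Walk y z ℓ → Walk x z (suc ℓ)

  Connected : Set
  Connected = ∀ x y → ∃ λ ℓ → Walk x y ℓ

  Dist : Fin n → Fin n → ℕ → Set
  Dist x y m = Walk x y m × (∀ ℓ → Walk x y ℓ → m ≤ ℓ)

  Distinguishes : Fin n → Fin n → Fin n → Set
  Distinguishes w x y = ∀ a b → Dist x w a → Dist y w b → a ≢ b

  IsKMetricGenerator : ℕ → (Fin n → Set) → Set
  IsKMetricGenerator k S =
    ∀ x y → x ≢ y →
      Σ (Fin k → Fin n) λ f → Injective _≡_ _≡_ f × (∀ i → S (f i) × Distinguishes (f i) x y)

  KMetricDimensional : ℕ → Set₁
  KMetricDimensional k =
    (∃ λ (S : Fin n → Set) → IsKMetricGenerator k S) ×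
    (∀ k' → (∃ λ (S : Fin n → Set) → IsKMetricGenerator k' S) → k' ≤ k)

  IsMinDegree : ℕ → Set
  IsMinDegree δ = (∃ λ v → degree v ≡ δ) × (∀ v → δ ≤ degree v)

  IsMaxDegree : ℕ → Set
  IsMaxDegree Δ = (∃ λ v → degree v ≡ Δ) × (∀ v → degree v ≤ Δ)

  Cycle : ℕ → Set
  Cycle zero = ⊥
  Cycle (suc m) = 2 ≤ m × Σ (Fin (suc m) → Fin n) λ c →
    Injective _≡_ _≡_ c ×
    (∀ (i : Fin m) → Adj (c (inject₁ i)) (c (suc i))) ×
    Adj (c (fromℕ m)) (c zero)

  IsGirth : ℕ → Set
  IsGirth g = Cycle g × (∀ ℓ → Cycle ℓ → g ≤ ℓ)

sumUpTo : ℕ → (ℕ → ℕ) → ℕ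
sumUpTo zero f = f 0
sumUpTo (suc m) f = sumUpTo m f + f (suc m)

module Submission where

-- Let v be a vertex of maximum degree Δ, and split its
-- neighbours into x, y and u₁, …, u_{Δ-2}.  Set m = ⌊g/2⌋ - 2 and r = δ - 1.
-- Grow from v the "spokes": the trivial walk at v, and every
-- non-backtracking walk v, uᵢ, … of length at most m + 1, where each step
-- chooses one of r neighbours of the current vertex other than the previous
-- one.  There are 1 + (Δ - 2)(1 + r + ⋯ + r^m) spokes.  Because the girth is
-- g, two non-backtracking walks with common ends and total length < g
-- coincide, and a non-backtracking walk of length ≤ g/2 is a shortest path.
-- Hence the spokes end in pairwise distinct vertices w, and prefixing x (or
-- y) to a spoke gives a shortest path, so d(x,w) = d(y,w): no such w
-- distinguishes x and y.  A k-metric generator contains k vertices that do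
-- distinguish x and y, and these are distinct from all the w, so k plus
-- the number of spokes is at most n.

open import Defs
open import Data.Nat using (ℕ; zero; suc; _+_; _*_; _∸_; _^_; _≤_; _<_; z≤n; s≤s; s≤s⁻¹; _≤?_; _/_)
open import Data.Nat.Properties
open import Data.Nat.DivMod using (m/n*n≤m; /-monoˡ-≤)
open import Data.Fin using (Fin; toℕ; inject₁; fromℕ; inject≤; punchIn; remQuot; splitAt) renaming (zero to fzero; suc to fsuc)
open import Data.Fin.Properties using (toℕ-injective; toℕ<n; toℕ-inject₁; toℕ-fromℕ; inject≤-injective; punchIn-injective; punchInᵢ≢i; any?; injective⇒≤; *↔×; +↔⊎) renaming (_≟_ to _≟ᶠ_; 0≢1+n to fzero≢fsuc; suc-injective to fsuc-injective)
open import Data.Empty using (⊥-elim)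
open import Data.Bool using (T)
open import Data.Product using (Σ; _×_; _,_; proj₁; proj₂)
open import Data.Sum using (_⊎_; inj₁; inj₂; [_,_]′)
open import Data.List using (List; filterᵇ; allFin; lookup)
open import Data.List.Relation.Unary.All as All using ()
open import Data.List.Relation.Unary.AllPairs using (_∷_)
open import Data.List.Relation.Unary.Unique.Propositional using (Unique)
open import Data.List.Relation.Unary.Unique.Propositional.Properties using (allFin⁺; filter⁺)
open import Data.List.Membership.Propositional.Properties using (∈-lookup; ∈-filter⁻)
open import Relation.Binary using (tri<; tri≈; tri>)
open import Relation.Binary.PropositionalEquality
open import Relation.Nullary using (¬_; yes; no)
open import Relation.Nullary.Decidable using (T?)
open import Function.Bundles using (Injection)
open import Function.Definitions using (Injective)
open import Function.Properties.Inverse using (↔⇒↣)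

lookup-injective : ∀ {A : Set} {xs : List A} → Unique xs → Injective _≡_ _≡_ (lookup xs)
lookup-injective (_ ∷ _) {fzero} {fzero} _ = refl
lookup-injective (x∉ ∷ _) {fzero} {fsuc j} e = ⊥-elim (All.lookup x∉ (∈-lookup j) e)
lookup-injective (x∉ ∷ _) {fsuc i} {fzero} e = ⊥-elim (All.lookup x∉ (∈-lookup i) (sym e))
lookup-injective (_ ∷ u) {fsuc i} {fsuc j} e = cong fsuc (lookup-injective u e)

copair-injective : ∀ {A B C : Set} {f : A → C} {h : B → C} →
  Injective _≡_ _≡_ f → Injective _≡_ _≡_ h → (∀ a b → f a ≢ h b) →
  Injective _≡_ _≡_ [ f , h ]′
copair-injective f-inj _ _ {inj₁ a} {inj₁ a′} e = cong inj₁ (f-inj e)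
copair-injective _ _ disjoint {inj₁ a} {inj₂ b} e = ⊥-elim (disjoint a b e)
copair-injective _ _ disjoint {inj₂ b} {inj₁ a} e = ⊥-elim (disjoint a b (sym e))
copair-injective _ h-inj _ {inj₂ b} {inj₂ b′} e = cong inj₂ (h-inj e)

splitAt-injective : ∀ m {k} → Injective _≡_ _≡_ (splitAt m {k})
splitAt-injective m {k} = Injection.injective (↔⇒↣ (+↔⊎ {m} {k}))

remQuot-injective : ∀ {m} k → Injective _≡_ _≡_ (remQuot {m} k)
remQuot-injective {m} k = Injection.injective (↔⇒↣ (*↔× {m} {k}))

avoiding : ∀ {n d} (h : Fin (suc d) → Fin n) → Injective _≡_ _≡_ h → (b : Fin n) →
  Σ (Fin d → Fin (suc d)) λ π → Injective _≡_ _≡_ π × (∀ i → h (π i) ≢ b)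
avoiding h h-inj b with any? (λ j → h j ≟ᶠ b)
... | yes (j , hj≡b) = punchIn j , (λ {i} {i′} → punchIn-injective j i i′) ,
                       λ i e → punchInᵢ≢i j i (h-inj (trans e (sym hj≡b)))
... | no none = fsuc , fsuc-injective , λ i e → none (fsuc i , e)

distinct⇒injective : ∀ {A : Set} (f : ℕ → A) M → (∀ s t → s < t → t ≤ M → f s ≢ f t) →
  ∀ {s t} → s ≤ M → t ≤ M → f s ≡ f t → s ≡ t
distinct⇒injective f M distinct {s} {t} s≤M t≤M e with <-cmp s t
... | tri< s<t _ _ = ⊥-elim (distinct s t s<t t≤M e)
... | tri≈ _ s≡t _ = s≡t
... | tri> _ _ t<s = ⊥-elim (distinct t s t<s s≤M (sym e))

-- A walk of length L is read off a sequence as f 0, f 1, …, f L.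
Seq : ℕ → Set
Seq n = ℕ → Fin n

cons : ∀ {n} → Fin n → Seq n → Seq n
cons x f zero    = x
cons x f (suc i) = f i

tail : ∀ {n} → Seq n → Seq n
tail f i = f (suc i)

module Walks {n : ℕ} (G : Graph n) where
  open Graph G using (irrefl) renaming (sym to edge-sym)

  adj-sym : ∀ {a b} → Adj G a b → Adj G b a
  adj-sym {a} {b} = subst T (edge-sym a b)

  adj-irrefl : ∀ {a b} → Adj G a b → a ≢ b
  adj-irrefl {a} a~a refl = irrefl a a~a

  IsWalk : Seq n → ℕ → Set
  IsWalk f L = ∀ i → i < L → Adj G (f i) (f (suc i))

  NonBacktracking : Seq n → ℕ → Set
  NonBacktracking f L = ∀ i → suc (suc i) ≤ L → f i ≢ f (suc (suc i))

  record IsNBWalk (f : Seq n) (L : ℕ) : Set where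
    field
      walk            : IsWalk f L
      nonBacktracking : NonBacktracking f L
  open IsNBWalk public

  length-zero-nb : ∀ f → IsNBWalk f 0
  length-zero-nb f = record { walk = λ _ () ; nonBacktracking = λ _ () }

  tail-walk : ∀ {f L} → IsWalk f (suc L) → IsWalk (tail f) L
  tail-walk w i i<L = w (suc i) (s≤s i<L)

  tail-nb : ∀ {f L} → IsNBWalk f (suc L) → IsNBWalk (tail f) L
  tail-nb P = record { walk = tail-walk (walk P)
                     ; nonBacktracking = λ i le → nonBacktracking P (suc i) (s≤s le) }

  cons-nb : ∀ {x f L} → Adj G x (f 0) → (1 ≤ L → x ≢ f 1) → IsNBWalk f L →
            IsNBWalk (cons x f) (suc L)
  cons-nb x~f0 turn P = record
    { walk = λ { zero _ → x~f0 ; (suc i) (s≤s i<L) → walk P i i<L }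
    ; nonBacktracking = λ { zero (s≤s 1≤L) → turn 1≤L
                          ; (suc i) (s≤s le) → nonBacktracking P i le } }

  toWalk : ∀ f L → IsWalk f L → Walk G (f 0) (f L) L
  toWalk f zero _ = here
  toWalk f (suc L) w = step (w 0 (s≤s z≤n)) (toWalk (tail f) L (tail-walk w))

  walkSeq : ∀ {x y ℓ} → Walk G x y ℓ → Seq n
  walkSeq (here {x}) _ = x
  walkSeq (step {x} _ w) = cons x (walkSeq w)

  walkSeq-start : ∀ {x y ℓ} (w : Walk G x y ℓ) → walkSeq w 0 ≡ x
  walkSeq-start here = refl
  walkSeq-start (step _ _) = refl

  walkSeq-end : ∀ {x y ℓ} (w : Walk G x y ℓ) → walkSeq w ℓ ≡ y
  walkSeq-end here = refl
  walkSeq-end (step _ w) = walkSeq-end w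

  walkSeq-walk : ∀ {x y ℓ} (w : Walk G x y ℓ) → IsWalk (walkSeq w) ℓ
  walkSeq-walk (step {x} x~y w) zero _ = subst (Adj G x) (sym (walkSeq-start w)) x~y
  walkSeq-walk (step _ w) (suc i) (s≤s i<ℓ) = walkSeq-walk w i i<ℓ

  record Reduct (f : Seq n) (L : ℕ) : Set where
    field
      len     : ℕ
      seq     : Seq n
      nb      : IsNBWalk seq len
      shorter : len ≤ L
      starts  : seq 0 ≡ f 0
      ends    : seq len ≡ f L

  -- Every walk reduces to a non-backtracking one: reduce the tail, then
  -- either prefix the first vertex or, if the reduced tail returns to it at
  -- once, cancel that backtrack.
  reduce : ∀ L (f : Seq n) → IsWalk f L → Reduct f L
  reduce zero f _ = record { len = 0 ; seq = f ; nb = length-zero-nb f ; shorter = z≤n ; starts = refl ; ends = refl }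
  reduce (suc L) f w = prepend (reduce L (tail f) (tail-walk w))
    where
    first-step : ∀ (s : Seq n) → s 0 ≡ f 1 → Adj G (f 0) (s 0)
    first-step s s0 = subst (Adj G (f 0)) (sym s0) (w 0 (s≤s z≤n))
    prepend : Reduct (tail f) L → Reduct f (suc L)
    prepend record { len = zero ; seq = s ; nb = N ; starts = s0 ; ends = sℓ } =
      record { len = 1 ; seq = cons (f 0) s ; nb = cons-nb (first-step s s0) (λ ()) N
             ; shorter = s≤s z≤n ; starts = refl ; ends = sℓ }
    prepend record { len = suc ℓ ; seq = s ; nb = N ; shorter = sh ; starts = s0 ; ends = sℓ } with s 1 ≟ᶠ f 0
    ... | yes backtrack =
      record { len = ℓ ; seq = tail s ; nb = tail-nb N ; shorter = ≤-trans (n≤1+n ℓ) (m≤n⇒m≤1+n sh)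
             ; starts = backtrack ; ends = sℓ }
    ... | no turn =
      record { len = suc (suc ℓ) ; seq = cons (f 0) s ; nb = cons-nb (first-step s s0) (λ _ e → turn (sym e)) N
             ; shorter = s≤s sh ; starts = refl ; ends = sℓ }

  -- revApp p P Q traces P backwards from P p to P 1 and then follows Q;
  -- when P 0 = Q 0 this is the walk P⁻¹Q of length p + q.
  revApp : ℕ → Seq n → Seq n → Seq n
  revApp zero P Q = Q
  revApp (suc p) P Q = revApp p (tail P) (cons (P 1) Q)

  revApp-start : ∀ p {P Q} → P 0 ≡ Q 0 → revApp p P Q 0 ≡ P p
  revApp-start zero e0 = sym e0
  revApp-start (suc p) _ = revApp-start p refl

  revApp-end : ∀ p q P Q → revApp p P Q (p + q) ≡ Q q
  revApp-end zero q P Q = refl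
  revApp-end (suc p) q P Q =
    trans (cong (revApp p (tail P) (cons (P 1) Q)) (sym (+-suc p q)))
          (revApp-end p (suc q) (tail P) (cons (P 1) Q))

  revApp-nb : ∀ p q {P Q} → IsNBWalk P p → IsNBWalk Q q → P 0 ≡ Q 0 →
              (1 ≤ p → 1 ≤ q → P 1 ≢ Q 1) → IsNBWalk (revApp p P Q) (p + q)
  revApp-nb zero q _ NQ _ _ = NQ
  revApp-nb (suc p) q {P} {Q} NP NQ e0 diverge =
    subst (IsNBWalk (revApp (suc p) P Q)) (+-suc p q)
      (revApp-nb p (suc q) {tail P} {cons (P 1) Q} (tail-nb NP) (cons-nb P1~Q0 (diverge (s≤s z≤n)) NQ) refl diverge′)
    where
    P1~Q0 : Adj G (P 1) (Q 0)
    P1~Q0 = subst (Adj G (P 1)) e0 (adj-sym (walk NP 0 (s≤s z≤n)))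
    diverge′ : 1 ≤ p → 1 ≤ suc q → P 2 ≢ Q 0
    diverge′ 1≤p _ e = nonBacktracking NP 0 (s≤s 1≤p) (trans e0 (sym e))

module Girth {n : ℕ} (G : Graph n) (g : ℕ) (girth : ∀ ℓ → Cycle G ℓ → g ≤ ℓ) where
  open Walks G

  closedWalk⇒cycle : ∀ m (f : Seq n) → 2 ≤ m → IsWalk f (suc m) → f (suc m) ≡ f 0 →
                     (∀ s t → s < t → t ≤ m → f s ≢ f t) → Cycle G (suc m)
  closedWalk⇒cycle m f 2≤m w closed distinct = 2≤m , c , c-injective , c-adj , c-closes
    where
    c : Fin (suc m) → Fin n
    c i = f (toℕ i)
    c-injective : Injective _≡_ _≡_ c
    c-injective {i} {j} e =
      toℕ-injective (distinct⇒injective f m distinct (s≤s⁻¹ (toℕ<n i)) (s≤s⁻¹ (toℕ<n j)) e)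
    c-adj : ∀ (i : Fin m) → Adj G (c (inject₁ i)) (c (fsuc i))
    c-adj i rewrite toℕ-inject₁ i = w (toℕ i) (m<n⇒m<1+n (toℕ<n i))
    c-closes : Adj G (c (fromℕ m)) (c fzero)
    c-closes rewrite toℕ-fromℕ m = subst (Adj G (f m)) closed (w m ≤-refl)

  -- A non-backtracking walk shorter than the girth never revisits a vertex:
  -- a first revisit would close a cycle shorter than g.
  short-nb-walk-distinct : ∀ L (f : Seq n) → IsNBWalk f L → L < g →
                           ∀ s t → s < t → t ≤ L → f s ≢ f t
  short-nb-walk-distinct zero f _ _ _ zero () _
  short-nb-walk-distinct zero f _ _ _ (suc _) _ ()
  short-nb-walk-distinct (suc L) f _ _ _ zero () _
  short-nb-walk-distinct (suc L) f P L<g (suc s) (suc t) (s≤s s<t) (s≤s t≤L) =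
    short-nb-walk-distinct L (tail f) (tail-nb P) (<-trans (n<1+n L) L<g) s t s<t t≤L
  short-nb-walk-distinct (suc L) f P _ zero 1 _ _ = adj-irrefl (walk P 0 (s≤s z≤n))
  short-nb-walk-distinct (suc L) f P _ zero 2 _ 2≤L = nonBacktracking P 0 2≤L
  short-nb-walk-distinct (suc L) f P L<g zero (suc (suc (suc t))) _ t+3≤L+1 f0≡f =
    <⇒≱ (≤-<-trans t+3≤L+1 L<g)
        (girth _ (closedWalk⇒cycle (suc (suc t)) f (s≤s (s≤s z≤n))
                   (λ i i< → walk P i (≤-trans i< t+3≤L+1)) (sym f0≡f) distinct))
    where
    later : ∀ s t′ → s < t′ → t′ ≤ L → f (suc s) ≢ f (suc t′)
    later = short-nb-walk-distinct L (tail f) (tail-nb P) (<-trans (n<1+n L) L<g)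
    distinct : ∀ s t′ → s < t′ → t′ ≤ suc (suc t) → f s ≢ f t′
    distinct _ zero () _
    distinct zero (suc t′) _ t′<t+2 e = later t′ (suc (suc t)) t′<t+2 (s≤s⁻¹ t+3≤L+1) (trans (sym e) f0≡f)
    distinct (suc s) (suc t′) (s≤s s<t′) t′≤ =
      later s t′ s<t′ (≤-trans (s≤s⁻¹ t′≤) (≤-trans (n≤1+n _) (s≤s⁻¹ t+3≤L+1)))

  -- Two non-backtracking walks with the same ends and total length below the
  -- girth are the same walk: where they first part, P⁻¹Q closes up too early.
  nb-walks-unique : ∀ p q {P Q : Seq n} → IsNBWalk P p → IsNBWalk Q q →
                    P 0 ≡ Q 0 → P p ≡ Q q → p + q < g →
                    p ≡ q × (∀ i → i ≤ p → P i ≡ Q i)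
  nb-walks-unique zero zero _ _ e0 _ _ = refl , λ { zero _ → e0 }
  nb-walks-unique zero (suc q) _ NQ e0 ep lt =
    ⊥-elim (short-nb-walk-distinct (suc q) _ NQ lt 0 (suc q) (s≤s z≤n) ≤-refl (trans (sym e0) ep))
  nb-walks-unique (suc p) zero NP _ e0 ep lt =
    ⊥-elim (short-nb-walk-distinct (suc p) _ NP (subst (_< g) (+-identityʳ _) lt) 0 (suc p) (s≤s z≤n) ≤-refl (trans e0 (sym ep)))
  nb-walks-unique (suc p) (suc q) {P} {Q} NP NQ e0 ep lt with P 1 ≟ᶠ Q 1
  ... | no parted =
    ⊥-elim (short-nb-walk-distinct (suc p + suc q) _ (revApp-nb (suc p) (suc q) {P} {Q} NP NQ e0 (λ _ _ → parted)) lt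
              0 (suc p + suc q) (s≤s z≤n) ≤-refl
              (trans (revApp-start (suc p) {P} {Q} e0) (trans ep (sym (revApp-end (suc p) (suc q) P Q)))))
  ... | yes e1 with nb-walks-unique p q (tail-nb NP) (tail-nb NQ) e1 ep
                      (≤-<-trans (+-monoʳ-≤ p (n≤1+n q)) (<-trans (n<1+n _) lt))
  ...   | p≡q , agree = cong suc p≡q , λ { zero _ → e0 ; (suc i) (s≤s i≤p) → agree i i≤p }

  short-nb-walk-geodesic : ∀ p (P : Seq n) → IsNBWalk P p → p + p ≤ g → Dist G (P 0) (P p) p
  short-nb-walk-geodesic p P NP p+p≤g = toWalk P p (walk NP) , minimal
    where
    minimal : ∀ ℓ → Walk G (P 0) (P p) ℓ → p ≤ ℓ
    minimal ℓ W with p ≤? ℓ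
    ... | yes p≤ℓ = p≤ℓ
    ... | no p≰ℓ = ⊥-elim (<⇒≢ len<p (sym (proj₁ (nb-walks-unique p len NP nb
                      (sym (trans starts (walkSeq-start W))) (sym (trans ends (walkSeq-end W)))
                      (<-≤-trans (+-monoʳ-< p len<p) p+p≤g)))))
      where
      open Reduct (reduce ℓ (walkSeq W) (walkSeq-walk W))
      len<p : len < p
      len<p = ≤-<-trans shorter (≰⇒> p≰ℓ)

module Branching {n : ℕ} (G : Graph n) where
  open Walks G

  record Branch (Prev : Fin n → Set) (b : Fin n) (j : ℕ) : Set where
    field
      len     : ℕ
      seq     : Seq n
      nb      : IsNBWalk seq len
      starts  : seq 0 ≡ b
      departs : 1 ≤ len → ¬ Prev (seq 1)
      bounded : len ≤ j

    end : Fin n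
    end = seq len
  open Branch public

  stop : ∀ {Prev b j} → Branch Prev b j
  stop {b = b} = record { len = 0 ; seq = λ _ → b ; nb = length-zero-nb _ ; starts = refl
                        ; departs = λ () ; bounded = z≤n }

  extend : ∀ {Prev b c j} → Adj G b c → ¬ Prev c → Branch (_≡ b) c j → Branch Prev b (suc j)
  extend {Prev} {b} b~c c-allowed B = record
    { len = suc (len B) ; seq = cons b (seq B)
    ; nb = cons-nb (subst (Adj G b) (sym (starts B)) b~c) (λ h e → departs B h (sym e)) (nb B)
    ; starts = refl ; departs = λ _ p → c-allowed (subst Prev (starts B) p)
    ; bounded = s≤s (bounded B) }

  SameWalk : ∀ {Prev b j} → Branch Prev b j → Branch Prev b j → Set
  SameWalk B B′ = len B ≡ len B′ × (∀ i → i ≤ len B → seq B i ≡ seq B′ i)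

  Faithful : ∀ {N Prev b j} → (Fin N → Branch Prev b j) → Set
  Faithful {N} B = ∀ (t t′ : Fin N) → SameWalk (B t) (B t′) → t ≡ t′

  module _ {Prev : Fin n → Set} {b : Fin n} {c j N : ℕ} (kid : Fin c → Fin n)
           (kid-adj : ∀ i → Adj G b (kid i)) (kid-allowed : ∀ i → ¬ Prev (kid i))
           (sub : ∀ i → Fin N → Branch (_≡ b) (kid i) j) where

    grow : Fin c × Fin N → Branch Prev b (suc j)
    grow (i , s) = extend (kid-adj i) (kid-allowed i) (sub i s)

    fan : Fin (suc (c * N)) → Branch Prev b (suc j)
    fan fzero = stop
    fan (fsuc t) = grow (remQuot N t)

    -- Distinct kids and faithful sub-branches give a faithful fan: the
    -- second vertex identifies the kid, the rest the sub-branch.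
    fan-faithful : Injective _≡_ _≡_ kid → (∀ i → Faithful (sub i)) → Faithful fan
    fan-faithful _ _ fzero fzero _ = refl
    fan-faithful _ _ fzero (fsuc _) (() , _)
    fan-faithful _ _ (fsuc _) fzero (() , _)
    fan-faithful kid-inj sub-faithful (fsuc t) (fsuc t′) same =
      cong fsuc (remQuot-injective N (grow-faithful (remQuot N t) (remQuot N t′) same))
      where
      grow-faithful : ∀ p p′ → SameWalk (grow p) (grow p′) → p ≡ p′
      grow-faithful (i , s) (i′ , s′) (eℓ , agree)
        with kid-inj (trans (sym (starts (sub i s))) (trans (agree 1 (s≤s z≤n)) (starts (sub i′ s′))))
      ... | refl = cong (i ,_) (sub-faithful i s s′ (suc-injective eℓ , λ k k≤ → agree (suc k) (s≤s k≤)))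

  module Tree (r : ℕ) (child : Fin n → Fin n → Fin r → Fin n)
              (child-adj : ∀ a b i → Adj G b (child a b i))
              (child-new : ∀ a b i → child a b i ≢ a)
              (child-inj : ∀ a b → Injective _≡_ _≡_ (child a b)) where

    treeSize : ℕ → ℕ
    treeSize zero    = 1
    treeSize (suc j) = suc (r * treeSize j)

    branch : ∀ j a b → Fin (treeSize j) → Branch (_≡ a) b j
    branch zero a b _ = stop
    branch (suc j) a b = fan (child a b) (child-adj a b) (child-new a b) (λ i → branch j b (child a b i))

    branch-faithful : ∀ j a b → Faithful (branch j a b)
    branch-faithful zero a b fzero fzero _ = refl
    branch-faithful (suc j) a b =
      fan-faithful (child a b) (child-adj a b) (child-new a b) (λ i → branch j b (child a b i))
                   (child-inj a b) (λ i → branch-faithful j b (child a b i))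

    treeSize-suc : ∀ j → treeSize (suc j) ≡ treeSize j + r ^ suc j
    treeSize-suc zero = refl
    treeSize-suc (suc j) = cong suc (begin
      r * treeSize (suc j)           ≡⟨ cong (r *_) (treeSize-suc j) ⟩
      r * (treeSize j + r ^ suc j)   ≡⟨ *-distribˡ-+ r (treeSize j) (r ^ suc j) ⟩
      r * treeSize j + r ^ suc (suc j) ∎)
      where open ≡-Reasoning

    treeSize≡geometric : ∀ j → treeSize j ≡ sumUpTo j (λ i → r ^ i)
    treeSize≡geometric zero = refl
    treeSize≡geometric (suc j) = trans (treeSize-suc j) (cong (_+ r ^ suc j) (treeSize≡geometric j))

equidistant-silent : ∀ {n} (G : Graph n) {w x y d} → Dist G x w d → Dist G y w d → ¬ Distinguishes G w x y
equidistant-silent G dx dy distinguishes = distinguishes _ _ dx dy refl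

module ShortBranches {n : ℕ} (G : Graph n) (g : ℕ) (girth : ∀ ℓ → Cycle G ℓ → g ≤ ℓ) where
  open Walks G
  open Girth G g girth
  open Branching G

  ends-injective : ∀ {N Prev b j} (B : Fin N → Branch Prev b j) → Faithful B →
                   suc j + suc j ≤ g → Injective _≡_ _≡_ (λ t → end (B t))
  ends-injective {j = j} B faithful fits {t} {t′} e =
    faithful t t′ (nb-walks-unique (len (B t)) (len (B t′)) (nb (B t)) (nb (B t′))
                     (trans (starts (B t)) (sym (starts (B t′)))) e
                     (<-≤-trans (≤-<-trans (+-mono-≤ (bounded (B t)) (bounded (B t′)))
                                           (s≤s (+-monoʳ-≤ j (n≤1+n j)))) fits))

  end-distance : ∀ {Prev b j z} (B : Branch Prev b j) → Adj G z b → Prev z →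
                 suc j + suc j ≤ g → Dist G z (end B) (suc (len B))
  end-distance {Prev} {z = z} B z~b z-forbidden fits =
    short-nb-walk-geodesic (suc (len B)) (cons z (seq B))
      (cons-nb (subst (Adj G z) (sym (starts B)) z~b) (λ h e → departs B h (subst Prev e z-forbidden)) (nb B))
      (≤-trans (+-mono-≤ (s≤s (bounded B)) (s≤s (bounded B))) fits)

  module Spokes (r : ℕ) (child : Fin n → Fin n → Fin r → Fin n)
                (child-adj : ∀ a b i → Adj G b (child a b i))
                (child-new : ∀ a b i → child a b i ≢ a)
                (child-inj : ∀ a b → Injective _≡_ _≡_ (child a b))
                {Δ′ : ℕ} (v : Fin n) (nbr : Fin (suc (suc Δ′)) → Fin n)
                (nbr-inj : Injective _≡_ _≡_ nbr) (nbr-adj : ∀ i → Adj G v (nbr i))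
                (m : ℕ) (fits : suc (suc m) + suc (suc m) ≤ g) where
    open Tree r child child-adj child-new child-inj public

    u : Fin Δ′ → Fin n
    u i = nbr (fsuc (fsuc i))

    Forbidden : Fin n → Set
    Forbidden z = z ≡ nbr fzero ⊎ z ≡ nbr (fsuc fzero)

    u-allowed : ∀ i → ¬ Forbidden (u i)
    u-allowed i (inj₁ e) = fzero≢fsuc (sym (nbr-inj e))
    u-allowed i (inj₂ e) = fzero≢fsuc (sym (fsuc-injective (nbr-inj e)))

    spoke : Fin (suc (Δ′ * treeSize m)) → Branch Forbidden v (suc m)
    spoke = fan u (λ i → nbr-adj _) u-allowed (λ i → branch m v (u i))

    spoke-faithful : Faithful spoke
    spoke-faithful = fan-faithful u _ u-allowed _ (λ e → fsuc-injective (fsuc-injective (nbr-inj e)))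
                                  (λ i → branch-faithful m v (u i))

    spokeEnd : Fin (suc (Δ′ * treeSize m)) → Fin n
    spokeEnd t = end (spoke t)

    spokeEnd-injective : Injective _≡_ _≡_ spokeEnd
    spokeEnd-injective = ends-injective spoke spoke-faithful fits

    spokeEnd-silent : ∀ t → ¬ Distinguishes G (spokeEnd t) (nbr fzero) (nbr (fsuc fzero))
    spokeEnd-silent t = equidistant-silent G (end-distance (spoke t) (adj-sym (nbr-adj _)) (inj₁ refl) fits)
                                             (end-distance (spoke t) (adj-sym (nbr-adj _)) (inj₂ refl) fits)

module Neighbours {n : ℕ} (G : Graph n) where
  open Graph G using (edge)

  neighbours : ∀ a {d} → d ≤ degree G a → Fin d → Fin n
  neighbours a d≤deg i = lookup (filterᵇ (edge a) (allFin n)) (inject≤ i d≤deg)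

  neighbours-adj : ∀ a {d} (d≤deg : d ≤ degree G a) i → Adj G a (neighbours a d≤deg i)
  neighbours-adj a d≤deg i = proj₂ (∈-filter⁻ (λ z → T? (edge a z)) {xs = allFin n} (∈-lookup (inject≤ i d≤deg)))

  neighbours-injective : ∀ a {d} (d≤deg : d ≤ degree G a) → Injective _≡_ _≡_ (neighbours a d≤deg)
  neighbours-injective a d≤deg e =
    inject≤-injective d≤deg d≤deg _ _ (lookup-injective (filter⁺ (λ z → T? (edge a z)) (allFin⁺ n)) e)

  module Children {r : ℕ} (minDegree : ∀ b → suc r ≤ degree G b) where
    private
      skip : ∀ a b → Σ (Fin r → Fin (suc r)) λ π →
               Injective _≡_ _≡_ π × (∀ i → neighbours b (minDegree b) (π i) ≢ a)
      skip a b = avoiding (neighbours b (minDegree b)) (neighbours-injective b (minDegree b)) a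

    child : Fin n → Fin n → Fin r → Fin n
    child a b i = neighbours b (minDegree b) (proj₁ (skip a b) i)

    child-adj : ∀ a b i → Adj G b (child a b i)
    child-adj a b i = neighbours-adj b (minDegree b) _

    child-new : ∀ a b i → child a b i ≢ a
    child-new a b = proj₂ (proj₂ (skip a b))

    child-inj : ∀ a b → Injective _≡_ _≡_ (child a b)
    child-inj a b e = proj₁ (proj₂ (skip a b)) (neighbours-injective b (minDegree b) e)

generator-bound : ∀ {n} (G : Graph n) {k S N x y} → IsKMetricGenerator G k S → x ≢ y →
                  (w : Fin N → Fin n) → Injective _≡_ _≡_ w → (∀ t → ¬ Distinguishes G (w t) x y) →
                  k + N ≤ n
generator-bound G {k} {x = x} {y} generator x≢y w w-inj w-silent with generator x y x≢y
... | f , f-inj , f-distinguishes =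
  injective⇒≤ {f = λ i → [ f , w ]′ (splitAt k i)}
              (λ e → splitAt-injective k (copair-injective f-inj w-inj disjoint e))
  where
  disjoint : ∀ i t → f i ≢ w t
  disjoint i t e = w-silent t (subst (λ v → Distinguishes G v x y) e (proj₂ (f-distinguishes i)))

halfGirth : ∀ g → 4 ≤ g → suc (suc (g / 2 ∸ 2)) + suc (suc (g / 2 ∸ 2)) ≤ g
halfGirth g 4≤g = subst (λ h → h + h ≤ g) (sym 2+[h∸2]≡h) (subst (_≤ g) h*2≡h+h (m/n*n≤m g 2))
  where
  2+[h∸2]≡h : suc (suc (g / 2 ∸ 2)) ≡ g / 2
  2+[h∸2]≡h = m+[n∸m]≡n (/-monoˡ-≤ 2 4≤g)
  h*2≡h+h : g / 2 * 2 ≡ g / 2 + g / 2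
  h*2≡h+h = trans (*-comm (g / 2) 2) (cong (g / 2 +_) (+-identityʳ (g / 2)))

theorem11 : ∀ {n} (G : Graph n) (δ Δ g k : ℕ) →
    Connected G → IsMinDegree G δ → IsMaxDegree G Δ → IsGirth G g →
    2 ≤ δ → 3 ≤ Δ → 4 ≤ g →
    KMetricDimensional G k →
    k + 1 + (Δ ∸ 2) * sumUpTo (g / 2 ∸ 2) (λ i → (δ ∸ 1) ^ i) ≤ n
theorem11 {n} G (suc r) (suc (suc Δ′)) g k _ (_ , minDegree) ((v , deg-v) , _) (_ , girth)
          (s≤s _) (s≤s (s≤s _)) 4≤g ((S , generator) , _) =
  subst (_≤ n) count (generator-bound G {S = S} generator x≢y spokeEnd spokeEnd-injective spokeEnd-silent)
  where
  open Neighbours G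
  open Children minDegree
  m : ℕ
  m = g / 2 ∸ 2
  -- v has maximum degree Δ′ + 2; its first two neighbours play the roles of x and y
  deg≥ : suc (suc Δ′) ≤ degree G v
  deg≥ = ≤-reflexive (sym deg-v)
  open ShortBranches.Spokes G g girth r child child-adj child-new child-inj
         v (neighbours v deg≥) (neighbours-injective v deg≥) (neighbours-adj v deg≥) m (halfGirth g 4≤g)
  x≢y : neighbours v deg≥ fzero ≢ neighbours v deg≥ (fsuc fzero)
  x≢y e = fzero≢fsuc (neighbours-injective v deg≥ e)
  count : k + suc (Δ′ * treeSize m) ≡ k + 1 + Δ′ * sumUpTo m (λ i → r ^ i)
  count = trans (sym (+-assoc k 1 _)) (cong (λ s → k + 1 + Δ′ * s) (treeSize≡geometric m))
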